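{- Let $k\ge 0$, let $V_u^k=\{v_1<v_2<\dots<v_m\}$ in lexicographic order, and let $i\in[k+4]$ with $J_i=\{t_1<t_2<\dots<t_{r_i}\}$. The following maps are order-preserving (with respect to inclusion on the domain): (i) $\varphi':\mathcal{P}_2^k\to\{a'_1>a'_2>\dots>a'_{k+4}>a'\}$ defined by $(\varphi')^{ -1}(a'_{i'})=\bigsqcup_{j\in J_{i'}}\mathcal{Q}_{i',j}^k$ for $i'\in[k+4]$ and $(\varphi')^{ -1}(a')=\mathcal{P}_1^k$; (ii) $\varphi'_i:\bigsqcup_{j\in J_i}\mathcal{Q}_{i,j}^k\to\{c'_{t_1}>c'_{t_2}>\dots>c'_{t_{r_i}}\}$ defined by $(\varphi'_i)^{ -1}(c'_j)=\mathcal{Q}_{i,j}^k$; (iii) for $j\in J_i$, $\varphi'_{i,j}:\mathcal{Q}_{i,j}^k\to\{b_{v_1}>b_{v_2}>\dots>b_{v_m}\}$ defined by $(\varphi'_{i,j})^{ -1}(b_{v_s})=\{\sigma\in\mathcal{Q}_{i,j}^k : v_s\in\sigma,\ v_t\notin\sigma\text{ for all } t<s\}$ for $s\in[m]$.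
   Context: For a positive integer $n$, $[n]=\{1,\dots,n\}$; arithmetic on $[k+6]$ is mod $k+6$ with representatives in $[k+6]$. $KG_{3,k}$ has as vertices the $3$-element subsets of $[k+6]$, adjacent iff disjoint; vertices are written as increasing triples and ordered lexicographically. A vertex $v$ is stable if there is no $t\in[k+6]$ with $\{t,t+1\}\subseteq v$ (mod $k+6$), unstable otherwise; $V_u^k$ is the set of unstable vertices. $S_{3,k}$ has the same vertices as $KG_{3,k}$ and the edges of $KG_{3,k}$ with at least one stable endpoint. For a graph $G$, $\mathcal{N}(G)$ is the neighborhood complex (simplices: nonempty vertex sets with a common neighbor in $G$). For a set $\sigma$ of vertices, $C_\sigma=[k+6]\setminus\bigcup_{\alpha\in\sigma}\alpha$. Let $X_1^k=\mathcal{N}(S_{3,k})$, $X_3^k=\mathcal{N}(KG_{3,k})$, $X_2^k=X_1^k\sqcup\{\sigma\in X_3^k\setminus X_1^k : |C_\sigma|=4\}$, and $\mathcal{P}_i^k$ the face poset of $X_i^k$. For $s\in[k+6]$: $J_s=[k+5]\setminus[2]$ if $s=1$, $J_s=[k+6]\setminus[s+1]$ if $1<s<k+5$, $J_s=\emptyset$ otherwise. For $i\in[k+4]$, $j\in J_i$: $\mathcal{Q}_{i,j}^k=\{\sigma\in\mathcal{P}_2^k\setminus\mathcal{P}_1^k : C_\sigma=\{i,i+1,j,j+1\}\}$. -}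

module Defs where

open import Data.Nat using (ℕ; zero; suc; _+_; _≤_; _<_; _≡ᵇ_)
open import Data.Bool using (if_then_else_)
open import Data.Product using (Σ; ∃; ∃-syntax; _×_; _,_)
open import Data.Sum using (_⊎_)
open import Data.Empty using (⊥)
open import Data.Unit using (⊤)
open import Relation.Nullary using (¬_)
open import Relation.Unary using (Pred; _∈_; _∉_; _⊆_)
open import Relation.Binary.PropositionalEquality using (_≡_)
open import Level using (0ℓ)
open import Function.Bundles using (_⇔_)

-- Ground set [k+6] = {1,…,k+6}.
N : ℕ → ℕ
N k = k + 6

-- t ↦ t+1 modulo k+6, with representatives in [k+6].
nxt : ℕ → ℕ → ℕ
nxt k t = if t ≡ᵇ N k then 1 else suc t

-- A vertex of KG_{3,k} is written as an increasing triple (a,b,c).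
Triple : Set
Triple = ℕ × ℕ × ℕ

IsVertex : ℕ → Triple → Set
IsVertex k (a , b , c) = 1 ≤ a × a < b × b < c × c ≤ N k

_∈ᵥ_ : ℕ → Triple → Set
x ∈ᵥ (a , b , c) = x ≡ a ⊎ x ≡ b ⊎ x ≡ c

Disjoint : Triple → Triple → Set
Disjoint v w = ∀ x → x ∈ᵥ v → x ∈ᵥ w → ⊥

Unstable : ℕ → Triple → Set
Unstable k v = ∃[ t ] (1 ≤ t × t ≤ N k × t ∈ᵥ v × nxt k t ∈ᵥ v)

Stable : ℕ → Triple → Set
Stable k v = ¬ Unstable k v

IsUnstableVertex : ℕ → Triple → Set
IsUnstableVertex k v = IsVertex k v × Unstable k v

_<lex_ : Triple → Triple → Set
(a , b , c) <lex (a' , b' , c') =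
  a < a' ⊎ (a ≡ a' × b < b') ⊎ (a ≡ a' × b ≡ b' × c < c')

Simplex : Set₁
Simplex = Pred Triple 0ℓ

IsVertexSet : ℕ → Simplex → Set
IsVertexSet k σ = (∀ v → v ∈ σ → IsVertex k v) × (∃[ v ] (v ∈ σ))

AdjKG : ℕ → Triple → Triple → Set
AdjKG k v w = IsVertex k v × IsVertex k w × Disjoint v w

AdjS : ℕ → Triple → Triple → Set
AdjS k v w = AdjKG k v w × (Stable k v ⊎ Stable k w)

-- face poset of the neighborhood complex N(G): nonempty vertex sets with a common neighbor
InNbhd : (Triple → Triple → Set) → ℕ → Simplex → Set
InNbhd adj k σ = IsVertexSet k σ × (∃[ w ] (IsVertex k w × (∀ v → v ∈ σ → adj v w)))

InP1 : ℕ → Simplex → Set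
InP1 k σ = InNbhd (AdjS k) k σ

InP3 : ℕ → Simplex → Set
InP3 k σ = InNbhd (AdjKG k) k σ

C : ℕ → Simplex → Pred ℕ 0ℓ
C k σ x = 1 ≤ x × x ≤ N k × (∀ v → v ∈ σ → ¬ (x ∈ᵥ v))

Card4 : Pred ℕ 0ℓ → Set
Card4 P = ∃[ a ] ∃[ b ] ∃[ c ] ∃[ d ]
  (a < b × b < c × c < d × (∀ x → P x ⇔ (x ≡ a ⊎ x ≡ b ⊎ x ≡ c ⊎ x ≡ d)))

InP2minusP1 : ℕ → Simplex → Set
InP2minusP1 k σ = InP3 k σ × ¬ InP1 k σ × Card4 (C k σ)

InP2 : ℕ → Simplex → Set
InP2 k σ = InP1 k σ ⊎ InP2minusP1 k σ

InJ : ℕ → ℕ → ℕ → Set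
InJ k s j = (s ≡ 1 × 3 ≤ j × j ≤ k + 5)
          ⊎ (1 < s × s < k + 5 × suc (suc s) ≤ j × j ≤ N k)

InQ : ℕ → ℕ → ℕ → Simplex → Set
InQ k i j σ = InP2minusP1 k σ ×
  (∀ x → C k σ x ⇔ (x ≡ i ⊎ x ≡ nxt k i ⊎ x ≡ j ⊎ x ≡ nxt k j))

-- (i) target chain a'_1 > a'_2 > … > a'_{k+4} > a'
data T1 : Set where
  a′ : T1
  a′[_] : ℕ → T1

_≤T1_ : T1 → T1 → Set
a′ ≤T1 y = ⊤
a′[ i ] ≤T1 a′ = ⊥
a′[ i ] ≤T1 a′[ i' ] = i' ≤ i

Pre1 : ℕ → Simplex → T1 → Set
Pre1 k σ a′ = InP1 k σ
Pre1 k σ a′[ i' ] = 1 ≤ i' × i' ≤ k + 4 × (∃[ j ] (InJ k i' j × InQ k i' j σ))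

-- (ii) target chain c'_{t_1} > … > c'_{t_r}:  c'_j ≤ c'_{j'}  iff  j' ≤ j
_≤c_ : ℕ → ℕ → Set
j ≤c j' = j' ≤ j

-- (iii) target chain b_{v_1} > … > b_{v_m} (v_s in lex order):
-- b_v ≤ b_w  iff  w ≤lex v
_≤b_ : Triple → Triple → Set
v ≤b w = w ≡ v ⊎ w <lex v

Pre3 : ℕ → Simplex → Triple → Set
Pre3 k σ v = IsUnstableVertex k v × v ∈ σ ×
  (∀ u → IsUnstableVertex k u → u <lex v → u ∉ σ)

module Submission where

-- Order preservation of the three maps reduces to two facts.
--   (a) P_1^k is closed under taking nonempty subsets of vertices, so a face σ ⊆ τ with
--       τ ∈ P_1^k lies in P_1^k as well; hence φ' never sends σ ⊆ τ to a'_i above a'.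
--   (b) If σ ⊆ τ with σ ∈ Q_{i,j}^k and τ ∈ Q_{i',j'}^k then (i',j') = (i,j).  Indeed
--       C_τ ⊆ C_σ, and both sets are of the form {i, i+1, j, j+1} (mod k+6).  Listing
--       such a set increasingly gives a quadruple from which (i,j) can be read back
--       (the quadruple is (i,i+1,j,j+1), or (1,i,i+1,k+6) when j = k+6), and an
--       increasing quadruple contained in another one equals it.
-- By (a) and (b), maps (i) and (ii) never strictly decrease along σ ⊆ τ.  Part (iii)
-- only uses that the lexicographic order is total: the least unstable vertex of σ is
-- an unstable vertex of τ, hence not below the least unstable vertex of τ.

open import Defs
open import Data.Nat using (ℕ; _+_; _≤_)
open import Data.Product using (_×_)
open import Relation.Unary using (_⊆_; _∈_; _∉_)

open import Data.Nat using (suc; _<_; _≡ᵇ_; s≤s)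
open import Data.Nat.Properties
open import Data.Bool using (true; false; T)
open import Data.Product using (_,_; proj₁; proj₂; ∃-syntax)
open import Data.Sum using (_⊎_; inj₁; inj₂)
open import Data.Unit using (tt)
open import Function using (id)
open import Function.Bundles using (_⇔_; mk⇔; Equivalence)
open import Function.Properties.Equivalence using () renaming (trans to ⇔-trans)
open import Relation.Nullary using (contradiction)
open import Relation.Binary.PropositionalEquality
  using (_≡_; _≢_; refl; sym; trans; subst; cong)
open import Relation.Binary.Definitions using (tri<; tri≈; tri>)

open Equivalence using (to; from)

Quad : Set
Quad = ℕ × ℕ × ℕ × ℕ

Increasing : Quad → Set
Increasing (a , b , c , d) = a < b × b < c × c < d

_∈₄_ : ℕ → Quad → Set
x ∈₄ (a , b , c , d) = x ≡ a ⊎ x ≡ b ⊎ x ≡ c ⊎ x ≡ d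

lower-bounds : ∀ {a b c d x} → Increasing (a , b , c , d) → x ∈₄ (a , b , c , d) →
  a ≤ x × (a < x → b ≤ x) × (b < x → c ≤ x) × (c < x → x ≡ d)
lower-bounds (a<b , b<c , c<d) (inj₁ refl) =
  ≤-refl , (λ a<a → contradiction a<a (<-irrefl refl)) ,
  (λ b<a → contradiction b<a (<⇒≯ a<b)) ,
  (λ c<a → contradiction c<a (<⇒≯ (<-trans a<b b<c)))
lower-bounds (a<b , b<c , c<d) (inj₂ (inj₁ refl)) =
  <⇒≤ a<b , (λ _ → ≤-refl) , (λ b<b → contradiction b<b (<-irrefl refl)) ,
  (λ c<b → contradiction c<b (<⇒≯ b<c))
lower-bounds (a<b , b<c , c<d) (inj₂ (inj₂ (inj₁ refl))) =
  <⇒≤ (<-trans a<b b<c) , (λ _ → <⇒≤ b<c) , (λ _ → ≤-refl) ,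
  (λ c<c → contradiction c<c (<-irrefl refl))
lower-bounds (a<b , b<c , c<d) (inj₂ (inj₂ (inj₂ refl))) =
  <⇒≤ (<-trans (<-trans a<b b<c) c<d) , (λ _ → <⇒≤ (<-trans b<c c<d)) ,
  (λ _ → <⇒≤ c<d) , (λ _ → refl)

upper-bounds : ∀ {a b c d x} → Increasing (a , b , c , d) → x ∈₄ (a , b , c , d) →
  (x < d → x ≤ c) × (x < c → x ≤ b) × (x < b → x ≡ a)
upper-bounds (a<b , b<c , c<d) (inj₁ refl) =
  (λ _ → <⇒≤ (<-trans a<b b<c)) , (λ _ → <⇒≤ a<b) , (λ _ → refl)
upper-bounds (a<b , b<c , c<d) (inj₂ (inj₁ refl)) =
  (λ _ → <⇒≤ b<c) , (λ _ → ≤-refl) , (λ b<b → contradiction b<b (<-irrefl refl))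
upper-bounds (a<b , b<c , c<d) (inj₂ (inj₂ (inj₁ refl))) =
  (λ _ → ≤-refl) , (λ c<c → contradiction c<c (<-irrefl refl)) ,
  (λ c<b → contradiction c<b (<⇒≯ b<c))
upper-bounds (a<b , b<c , c<d) (inj₂ (inj₂ (inj₂ refl))) =
  (λ d<d → contradiction d<d (<-irrefl refl)) ,
  (λ d<c → contradiction d<c (<⇒≯ c<d)) ,
  (λ d<b → contradiction d<b (<⇒≯ (<-trans b<c c<d)))

increasing-⊆-≡ : ∀ {q q₁} → Increasing q → Increasing q₁ →
  (∀ x → x ∈₄ q₁ → x ∈₄ q) → q₁ ≡ q
increasing-⊆-≡ {a , b , c , d} {a₁ , b₁ , c₁ , d₁} inc (a₁<b₁ , b₁<c₁ , c₁<d₁) q₁⊆q =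
  quad-≡ a₁≡a b₁≡b c₁≡c d₁≡d
  where
  quad-≡ : a₁ ≡ a → b₁ ≡ b → c₁ ≡ c → d₁ ≡ d → (a₁ , b₁ , c₁ , d₁) ≡ (a , b , c , d)
  quad-≡ refl refl refl refl = refl
  a≤a₁ : a ≤ a₁
  a≤a₁ = proj₁ (lower-bounds inc (q₁⊆q a₁ (inj₁ refl)))
  b≤b₁ : b ≤ b₁
  b≤b₁ = proj₁ (proj₂ (lower-bounds inc (q₁⊆q b₁ (inj₂ (inj₁ refl)))))
    (≤-<-trans a≤a₁ a₁<b₁)
  c≤c₁ : c ≤ c₁
  c≤c₁ = proj₁ (proj₂ (proj₂ (lower-bounds inc (q₁⊆q c₁ (inj₂ (inj₂ (inj₁ refl)))))))
    (≤-<-trans b≤b₁ b₁<c₁)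
  d₁≡d : d₁ ≡ d
  d₁≡d = proj₂ (proj₂ (proj₂ (lower-bounds inc (q₁⊆q d₁ (inj₂ (inj₂ (inj₂ refl)))))))
    (≤-<-trans c≤c₁ c₁<d₁)
  c₁≡c : c₁ ≡ c
  c₁≡c = ≤-antisym
    (proj₁ (upper-bounds inc (q₁⊆q c₁ (inj₂ (inj₂ (inj₁ refl))))) (subst (c₁ <_) d₁≡d c₁<d₁))
    c≤c₁
  b₁≡b : b₁ ≡ b
  b₁≡b = ≤-antisym
    (proj₁ (proj₂ (upper-bounds inc (q₁⊆q b₁ (inj₂ (inj₁ refl))))) (subst (b₁ <_) c₁≡c b₁<c₁))
    b≤b₁
  a₁≡a : a₁ ≡ a
  a₁≡a = proj₂ (proj₂ (upper-bounds inc (q₁⊆q a₁ (inj₁ refl)))) (subst (a₁ <_) b₁≡b a₁<b₁)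

-- k+6 is never 4; this rules out a set {i,i+1,j,j+1} having both listing shapes.
four≢N : ∀ k → 4 ≢ N k
four≢N k = <⇒≢ (≤-trans (s≤s (n≤1+n 4)) (m≤n+m 6 k))

nxt-< : ∀ {k t} → t < N k → nxt k t ≡ suc t
nxt-< {k} {t} t<N with t ≡ᵇ N k in eq
... | false = refl
... | true  = contradiction (≡ᵇ⇒≡ t (N k) (subst T (sym eq) tt)) (<⇒≢ t<N)

nxt-N : ∀ k → nxt k (N k) ≡ 1
nxt-N k with N k ≡ᵇ N k in eq
... | true  = refl
... | false = contradiction (subst T eq (≡⇒≡ᵇ (N k) (N k) refl)) id

Pattern : ℕ → ℕ → ℕ → ℕ → Set
Pattern k i j x = x ≡ i ⊎ x ≡ nxt k i ⊎ x ≡ j ⊎ x ≡ nxt k j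

data SortedPattern (k i j : ℕ) : Quad → Set where
  inner : j < N k → SortedPattern k i j (i , suc i , j , suc j)
  wrap  : j ≡ N k → SortedPattern k i j (1 , i , suc i , j)

-- The listing determines (i, j); mixing the two shapes would force k+6 = 4.
sorted-pattern-injective : ∀ {k i j i₁ j₁ q} →
  SortedPattern k i j q → SortedPattern k i₁ j₁ q → i₁ ≡ i × j₁ ≡ j
sorted-pattern-injective (inner _) (inner _) = refl , refl
sorted-pattern-injective (wrap _)  (wrap _)  = refl , refl
sorted-pattern-injective {k} (inner _) (wrap 4≡N) = contradiction 4≡N (four≢N k)
sorted-pattern-injective {k} (wrap 4≡N) (inner _) = contradiction 4≡N (four≢N k)

J-i<N : ∀ {k i j} → InJ k i j → suc i < N k
J-i<N {k} (inj₁ (refl , _))          = ≤-trans (m≤m+n 3 3) (m≤n+m 6 k)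
J-i<N {k} {i} (inj₂ (_ , i<k+5 , _)) = subst (suc i <_) (sym (+-suc k 5)) (s≤s i<k+5)

J-nxt-i : ∀ {k i j} → InJ k i j → nxt k i ≡ suc i
J-nxt-i {i = i} j∈J = nxt-< (<-trans (n<1+n i) (J-i<N j∈J))

J-gap : ∀ {k i j} → InJ k i j → suc (suc i) ≤ j
J-gap (inj₁ (refl , 3≤j , _))    = 3≤j
J-gap (inj₂ (_ , _ , i+2≤j , _)) = i+2≤j

J-j≤N : ∀ {k i j} → InJ k i j → j ≤ N k
J-j≤N {k} (inj₁ (_ , _ , j≤k+5))  = ≤-trans j≤k+5 (+-monoʳ-≤ k (n≤1+n 5))
J-j≤N (inj₂ (_ , _ , _ , j≤N))    = j≤N

J-wrap : ∀ {k i j} → InJ k i j → j ≡ N k → 1 < i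
J-wrap {k} (inj₁ (_ , _ , j≤k+5)) j≡N =
  contradiction (subst (_≤ k + 5) j≡N j≤k+5) (<⇒≱ (+-monoʳ-< k (n<1+n 5)))
J-wrap (inj₂ (1<i , _)) _ = 1<i

pattern-≡ : ∀ {k i j i₁ j₁ x} → nxt k i ≡ i₁ → nxt k j ≡ j₁ →
  Pattern k i j x ⇔ (x ≡ i ⊎ x ≡ i₁ ⊎ x ≡ j ⊎ x ≡ j₁)
pattern-≡ refl refl = mk⇔ id id

rotate : ∀ {A B C D : Set} → (A ⊎ B ⊎ C ⊎ D) ⇔ (D ⊎ A ⊎ B ⊎ C)
rotate {A} {B} {C} {D} = mk⇔ forward backward
  where
  forward : A ⊎ B ⊎ C ⊎ D → D ⊎ A ⊎ B ⊎ C
  forward (inj₁ a)                = inj₂ (inj₁ a)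
  forward (inj₂ (inj₁ b))         = inj₂ (inj₂ (inj₁ b))
  forward (inj₂ (inj₂ (inj₁ c)))  = inj₂ (inj₂ (inj₂ c))
  forward (inj₂ (inj₂ (inj₂ d)))  = inj₁ d
  backward : D ⊎ A ⊎ B ⊎ C → A ⊎ B ⊎ C ⊎ D
  backward (inj₁ d)               = inj₂ (inj₂ (inj₂ d))
  backward (inj₂ (inj₁ a))        = inj₁ a
  backward (inj₂ (inj₂ (inj₁ b))) = inj₂ (inj₁ b)
  backward (inj₂ (inj₂ (inj₂ c))) = inj₂ (inj₂ (inj₁ c))

sorted-pattern : ∀ {k i j} → InJ k i j →
  ∃[ q ] (SortedPattern k i j q × Increasing q × (∀ x → Pattern k i j x ⇔ x ∈₄ q))
sorted-pattern {k} {i} {j} j∈J with m≤n⇒m<n∨m≡n (J-j≤N j∈J)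
... | inj₁ j<N = _ , inner j<N , (≤-refl , J-gap j∈J , ≤-refl) ,
  λ x → pattern-≡ (J-nxt-i j∈J) (nxt-< j<N)
... | inj₂ j≡N = _ , wrap j≡N , (J-wrap j∈J j≡N , ≤-refl , subst (suc i <_) (sym j≡N) (J-i<N j∈J)) ,
  λ x → ⇔-trans (pattern-≡ (J-nxt-i j∈J) (trans (cong (nxt k) j≡N) (nxt-N k))) rotate

C-antitone : ∀ {k} {σ τ : Simplex} → σ ⊆ τ → C k τ ⊆ C k σ
C-antitone σ⊆τ (1≤x , x≤N , uncovered) = 1≤x , x≤N , λ v v∈σ → uncovered v (σ⊆τ v∈σ)

Q-index-unique : ∀ {k i j i₁ j₁} {σ τ : Simplex} → InJ k i j → InJ k i₁ j₁ →
  InQ k i j σ → InQ k i₁ j₁ τ → σ ⊆ τ → i₁ ≡ i × j₁ ≡ j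
Q-index-unique {k} {i₁ = i₁} {j₁} j∈J j₁∈J₁ (_ , Cσ) (_ , Cτ) σ⊆τ =
  let (q , sp , inc , pat) = sorted-pattern j∈J
      (q₁ , sp₁ , inc₁ , pat₁) = sorted-pattern j₁∈J₁
      -- C_τ ⊆ C_σ, read through both listings
      q₁⊆q : ∀ x → x ∈₄ q₁ → x ∈₄ q
      q₁⊆q x x∈q₁ = to (pat x) (to (Cσ x) (C-antitone σ⊆τ (from (Cτ x) (from (pat₁ x) x∈q₁))))
  in sorted-pattern-injective sp (subst (SortedPattern k i₁ j₁) (increasing-⊆-≡ inc inc₁ q₁⊆q) sp₁)

nbhd-downward : ∀ {adj k} {σ τ : Simplex} → σ ⊆ τ → IsVertexSet k σ →
  InNbhd adj k τ → InNbhd adj k σ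
nbhd-downward σ⊆τ σ-vertices (_ , w , w-vertex , w-adj) =
  σ-vertices , w , w-vertex , λ v v∈σ → w-adj v (σ⊆τ v∈σ)

lex-trichotomy : ∀ (v w : Triple) → w ≡ v ⊎ w <lex v ⊎ v <lex w
lex-trichotomy (a , b , c) (a₁ , b₁ , c₁) with <-cmp a a₁
... | tri< a<a₁ _ _ = inj₂ (inj₂ (inj₁ a<a₁))
... | tri> _ _ a₁<a = inj₂ (inj₁ (inj₁ a₁<a))
... | tri≈ _ refl _ with <-cmp b b₁
...   | tri< b<b₁ _ _ = inj₂ (inj₂ (inj₂ (inj₁ (refl , b<b₁))))
...   | tri> _ _ b₁<b = inj₂ (inj₁ (inj₂ (inj₁ (refl , b₁<b))))
...   | tri≈ _ refl _ with <-cmp c c₁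
...     | tri< c<c₁ _ _ = inj₂ (inj₂ (inj₂ (inj₂ (refl , refl , c<c₁))))
...     | tri> _ _ c₁<c = inj₂ (inj₁ (inj₂ (inj₂ (refl , refl , c₁<c))))
...     | tri≈ _ refl _ = inj₁ refl

least-unstable : ∀ {k} (τ : Simplex) {v w : Triple} → IsUnstableVertex k v → v ∈ τ →
  (∀ u → IsUnstableVertex k u → u <lex w → u ∉ τ) → v ≤b w
least-unstable τ {v} {w} v-unstable v∈τ w-least with lex-trichotomy v w
... | inj₁ w≡v        = inj₁ w≡v
... | inj₂ (inj₁ w<v) = inj₂ w<v
... | inj₂ (inj₂ v<w) = contradiction v∈τ (w-least v v-unstable v<w)

φ′-monotone : ∀ k (σ τ : Simplex) (x y : T1) → InP2 k σ → InP2 k τ → σ ⊆ τ →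
  Pre1 k σ x → Pre1 k τ y → x ≤T1 y
φ′-monotone k σ τ a′ y _ _ _ _ _ = tt
φ′-monotone k σ τ a′[ i ] a′ _ _ σ⊆τ (_ , _ , _ , _ , ((σ-vertices , _) , σ∉P₁ , _) , _) τ∈P₁ =
  contradiction (nbhd-downward σ⊆τ σ-vertices τ∈P₁) σ∉P₁
φ′-monotone k σ τ a′[ i ] a′[ i₁ ] _ _ σ⊆τ (_ , _ , j , j∈J , σ∈Q) (_ , _ , j₁ , j₁∈J , τ∈Q) =
  ≤-reflexive (proj₁ (Q-index-unique j∈J j₁∈J σ∈Q τ∈Q σ⊆τ))

-- Part (ii): φ′_i is order-preserving, because inclusion inside ⊔_j Q_{i,j}^k fixes j.
φ′ᵢ-monotone : ∀ k i (σ τ : Simplex) (j j₁ : ℕ) → InJ k i j → InJ k i j₁ →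
  InQ k i j σ → InQ k i j₁ τ → σ ⊆ τ → j ≤c j₁
φ′ᵢ-monotone k i σ τ j j₁ j∈J j₁∈J σ∈Q τ∈Q σ⊆τ =
  ≤-reflexive (proj₂ (Q-index-unique j∈J j₁∈J σ∈Q τ∈Q σ⊆τ))

-- Part (iii): φ′_{i,j} is order-preserving, since the least unstable vertex of σ is an
-- unstable vertex of τ.
φ′ᵢⱼ-monotone : ∀ k i (j : ℕ) → InJ k i j → (σ τ : Simplex) (v w : Triple) →
  InQ k i j σ → InQ k i j τ → σ ⊆ τ → Pre3 k σ v → Pre3 k τ w → v ≤b w
φ′ᵢⱼ-monotone k i j _ σ τ v w _ _ σ⊆τ (v-unstable , v∈σ , _) (_ , _ , w-least) =
  least-unstable τ v-unstable (σ⊆τ v∈σ) w-least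

lemma4p5 : (k : ℕ) →
    ((σ τ : Simplex) (x y : T1) → InP2 k σ → InP2 k τ → σ ⊆ τ →
      Pre1 k σ x → Pre1 k τ y → x ≤T1 y)
    ×
    ((i : ℕ) → 1 ≤ i → i ≤ k + 4 →
      ((σ τ : Simplex) (j j' : ℕ) → InJ k i j → InJ k i j' →
        InQ k i j σ → InQ k i j' τ → σ ⊆ τ → j ≤c j')
      ×
      ((j : ℕ) → InJ k i j → (σ τ : Simplex) (v w : Triple) →
        InQ k i j σ → InQ k i j τ → σ ⊆ τ →
        Pre3 k σ v → Pre3 k τ w → v ≤b w))
lemma4p5 k = φ′-monotone k , λ i _ _ → φ′ᵢ-monotone k i , φ′ᵢⱼ-monotone k i
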